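{- Let $R$ be a $k$-ary Boolean relation that is not balanced. Then there exists $u\in\{0,1\}^k\setminus R$ such that no polynomial $p_u$ of degree at most $1$ over any ring $E$ captures $u$ with respect to $R$.
   Context: A partial Boolean operation $f$ of arity $k$ is balanced if there are integers $\alpha_1,\ldots,\alpha_k$ with $\sum\alpha_i=1$ such that $(x_1,\ldots,x_k)$ is in its domain iff $\sum\alpha_ix_i\in\{0,1\}$, and then $f(x)=\sum\alpha_ix_i$. $f$ preserves $T\subseteq\{0,1\}^m$ if for all $t^1,\ldots,t^k\in T$, whenever the coordinatewise application of $f$ is defined in every coordinate, the result lies in $T$. A relation is balanced if preserved by all balanced operations. A polynomial $p_u$ in $k$ variables over a ring $E$ captures $u\in\{0,1\}^k\setminus R$ with respect to $R$ if, evaluated over $E$, $p_u(x)=0$ for all $x\in R$ and $p_u(u)\neq0$. -}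

module Defs where

open import Level using (0ℓ)
open import Data.Bool using (Bool; true; false; if_then_else_)
open import Data.Nat using (ℕ)
open import Data.Fin using (Fin)
open import Data.Integer using (ℤ; +_) renaming (_+_ to _+ℤ_; _*_ to _*ℤ_)
open import Data.Vec using (Vec; lookup)
open import Data.Product using (_×_)
open import Relation.Binary.PropositionalEquality using (_≡_)
open import Relation.Nullary using (¬_)
open import Algebra.Bundles using (Ring)

BoolRel : ℕ → Set
BoolRel k = Vec Bool k → Bool

b2ℤ : Bool → ℤ
b2ℤ true  = + 1
b2ℤ false = + 0

sumℤ : (m : ℕ) → (Fin m → ℤ) → ℤ
sumℤ ℕ.zero    f = + 0
sumℤ (ℕ.suc m) f = f Fin.zero +ℤ sumℤ m (λ i → f (Fin.suc i))

-- The balanced operation with coefficient vector α (Σ α = 1) preserves R: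
-- for all t¹..tᵐ ∈ R, whenever Σ αᵢ tⁱⱼ ∈ {0,1} in every coordinate j
-- (i.e. equals the 0/1 value rⱼ of some tuple r), the result r lies in R.
Preserves : (k m : ℕ) → (Fin m → ℤ) → BoolRel k → Set
Preserves k m α R =
  (t : Fin m → Vec Bool k) → (∀ i → R (t i) ≡ true) →
  (r : Vec Bool k) →
  (∀ j → sumℤ m (λ i → α i *ℤ b2ℤ (lookup (t i) j)) ≡ b2ℤ (lookup r j)) →
  R r ≡ true

Balanced : (k : ℕ) → BoolRel k → Set
Balanced k R =
  (m : ℕ) (α : Fin m → ℤ) → sumℤ m α ≡ + 1 → Preserves k m α R

module _ (E : Ring 0ℓ 0ℓ) where
  open Ring E

  sumE : (k : ℕ) → (Fin k → Carrier) → Carrier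
  sumE ℕ.zero    f = 0#
  sumE (ℕ.suc k) f = f Fin.zero + sumE k (λ i → f (Fin.suc i))

  record LinPoly (k : ℕ) : Set where
    constructor linPoly
    field
      const : Carrier
      coeff : Fin k → Carrier

  evalLin : {k : ℕ} → LinPoly k → Vec Bool k → Carrier
  evalLin {k} (linPoly c₀ c) x =
    c₀ + sumE k (λ i → c i * (if lookup x i then 1# else 0#))

  Captures : {k : ℕ} → BoolRel k → LinPoly k → Vec Bool k → Set
  Captures R p u =
    (∀ x → R x ≡ true → evalLin p x ≈ 0#) × ¬ (evalLin p u ≈ 0#)

module Submission where

open import Defs
open import Level using (0ℓ)
open import Data.Bool using (Bool; false)
open import Data.Nat using (ℕ)
open import Data.Vec using (Vec)
open import Data.Product using (Σ; _×_)
open import Relation.Binary.PropositionalEquality using (_≡_)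
open import Relation.Nullary using (¬_)
open import Algebra.Bundles using (Ring)

open import Data.Bool using (true; if_then_else_) renaming (_≟_ to _≟ᵇ_)
open import Data.Nat as ℕ using (zero; suc)
import Data.Nat.Properties as ℕP
import Data.Nat.Divisibility as ℕD
open import Data.Integer as ℤ using (ℤ; +_; +0; -[1+_])
import Data.Integer.Properties as ℤP
open import Data.Integer.Tactic.RingSolver using (solve-∀)
open import Data.Fin using (Fin; zero; suc)
open import Data.Vec using ([]; _∷_; lookup)
open import Data.Fin.Subset.Properties using (anySubset?)
open import Data.List using (List; []; _∷_; _++_; map; filter)
open import Data.List.Membership.Propositional using (_∈_)
open import Data.List.Membership.Propositional.Properties
  using (∈-map⁺; ∈-map⁻; ∈-++⁺ˡ; ∈-++⁺ʳ; ∈-++⁻; ∈-filter⁺; ∈-filter⁻)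
open import Data.List.Relation.Unary.Any using (here; there)
open import Data.Product using (_,_; proj₂)
open import Data.Sum using (inj₁; inj₂)
open import Data.Empty using (⊥-elim)
open import Relation.Binary.PropositionalEquality
  using (refl; sym; trans; cong; cong₂; subst; _≗_; _≢_)
open import Relation.Nullary using (Dec; yes; no)
open import Relation.Nullary.Decidable using (map′; _×-dec_)

-- Encode x ∈ {0,1}^k as the integer vector lift x = (1, x₁, …, x_k)
-- and let L ⊆ ℤ^(k+1) be the lattice spanned by the lifts of the tuples of R.
-- (1) A balanced operation applied to tuples of R yields the lift of its result
--     as an integer combination of lifts, so if no u ∉ R has lift u ∈ L, then R
--     is balanced.
-- (2) A polynomial c₀ + Σ cᵢxᵢ over a ring E, evaluated at x, is the pairing of
--     lift x with (c₀, …, c_k) through the canonical map ℤ → E; the pairing is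
--     linear, so if it vanishes on R it vanishes on L.  Hence no u with
--     lift u ∈ L is captured.
-- (3) Constructively, R not balanced only says that (1) fails; to extract a
--     witness u we decide membership in L.  This is done for arbitrary finitely
--     generated integer lattices by bringing the generators into echelon form
--     with Euclid's algorithm and recursing on the dimension.

-- Finitely generated lattices in ℤⁿ and decidability of membership.
module IntegerLattice where

  open import Data.Integer using (_+_; _*_; -_; _-_; ∣_∣; _≟_; ≢-nonZero)
  open import Data.Integer.DivMod using (_/_; _%_; a≡a%n+[a/n]*n; n%d<d)
  open import Data.Integer.Divisibility.Signed using (_∣_; divides; ∣ᵤ⇒∣; ∣⇒∣ᵤ)

  ZVec : ℕ → Set
  ZVec n = Fin n → ℤ

  data Span {n : ℕ} (G : List (ZVec n)) : ZVec n → Set where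
    span-zero : ∀ {v} → (∀ i → v i ≡ +0) → Span G v
    span-step : ∀ {v g w} (c : ℤ) → g ∈ G → Span G w →
                (∀ i → v i ≡ c * g i + w i) → Span G v

  module _ {n : ℕ} {G : List (ZVec n)} where

    span-resp : ∀ {v u} → Span G v → v ≗ u → Span G u
    span-resp (span-zero p)       e = span-zero (λ i → trans (sym (e i)) (p i))
    span-resp (span-step c m s p) e = span-step c m s (λ i → trans (sym (e i)) (p i))

    span-gen : ∀ {g} → g ∈ G → Span G g
    span-gen {g} m = span-step (+ 1) m (span-zero (λ _ → refl)) (λ i → one-times (g i))
      where
      one-times : ∀ x → x ≡ + 1 * x + +0
      one-times = solve-∀

    span-comb : ∀ {v w u} (a : ℤ) → Span G v → Span G w →
                (∀ i → u i ≡ a * v i + w i) → Span G u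
    span-comb {w = w} a (span-zero p) t e =
      span-resp t (λ i → sym (trans (e i) (trans (cong (λ x → a * x + w i) (p i)) (drop a (w i)))))
      where
      drop : ∀ a y → a * +0 + y ≡ y
      drop = solve-∀
    span-comb {w = w} a (span-step {g = g} {w = v′} c m s p) t e =
      span-step (a * c) m (span-comb a s t (λ _ → refl))
        (λ i → trans (e i) (trans (cong (λ x → a * x + w i) (p i)) (regroup a c (g i) (v′ i) (w i))))
      where
      regroup : ∀ a c x y z → a * (c * x + y) + z ≡ a * c * x + (a * y + z)
      regroup = solve-∀

  record Linear (n m : ℕ) : Set where
    field
      apply          : ZVec n → ZVec m
      preserves-zero : ∀ {v} → (∀ i → v i ≡ +0) → ∀ j → apply v j ≡ +0
      preserves-comb : ∀ {v g w} c → (∀ i → v i ≡ c * g i + w i) →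
                       ∀ j → apply v j ≡ c * apply g j + apply w j
  open Linear

  span-map : ∀ {n m} (L : Linear n m) {G : List (ZVec n)} {H : List (ZVec m)} →
             (∀ {g} → g ∈ G → Span H (apply L g)) →
             ∀ {v} → Span G v → Span H (apply L v)
  span-map L gen (span-zero p)       = span-zero (preserves-zero L p)
  span-map L gen (span-step c m s p) =
    span-comb c (gen m) (span-map L gen s) (preserves-comb L c p)

  identity : ∀ {n} → Linear n n
  identity = record { apply = λ v → v ; preserves-zero = λ p → p ; preserves-comb = λ c p → p }

  _⊑_ : ∀ {n} → List (ZVec n) → List (ZVec n) → Set
  G ⊑ H = ∀ {g} → g ∈ G → Span H g

  _≋_ : ∀ {n} → List (ZVec n) → List (ZVec n) → Set
  G ≋ H = G ⊑ H × H ⊑ G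

  module _ {n : ℕ} where

    span-mono : {G H : List (ZVec n)} → G ⊑ H → ∀ {v} → Span G v → Span H v
    span-mono = span-map identity

    ⊑-trans : {A B C : List (ZVec n)} → A ⊑ B → B ⊑ C → A ⊑ C
    ⊑-trans A⊑B B⊑C m = span-mono B⊑C (A⊑B m)

    ⊆⇒⊑ : {A B : List (ZVec n)} → (∀ {g} → g ∈ A → g ∈ B) → A ⊑ B
    ⊆⇒⊑ A⊆B m = span-gen (A⊆B m)

    ⊑-++ : {A B C : List (ZVec n)} → A ⊑ C → B ⊑ C → (A ++ B) ⊑ C
    ⊑-++ {A} A⊑C B⊑C m with ∈-++⁻ A m
    ... | inj₁ m′ = A⊑C m′
    ... | inj₂ m′ = B⊑C m′

    ≋-refl : {A : List (ZVec n)} → A ≋ A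
    ≋-refl = ⊆⇒⊑ (λ m → m) , ⊆⇒⊑ (λ m → m)

    ≋-trans : {A B C : List (ZVec n)} → A ≋ B → B ≋ C → A ≋ C
    ≋-trans (A⊑B , B⊑A) (B⊑C , C⊑B) = ⊑-trans A⊑B B⊑C , ⊑-trans C⊑B B⊑A

    ≋-++ : {A B C D : List (ZVec n)} → A ≋ B → C ≋ D → (A ++ C) ≋ (B ++ D)
    ≋-++ {A} {B} {C} {D} (A⊑B , B⊑A) (C⊑D , D⊑C) =
      ⊑-++ (⊑-trans A⊑B (⊆⇒⊑ ∈-++⁺ˡ)) (⊑-trans C⊑D (⊆⇒⊑ (∈-++⁺ʳ B))) ,
      ⊑-++ (⊑-trans B⊑A (⊆⇒⊑ ∈-++⁺ˡ)) (⊑-trans D⊑C (⊆⇒⊑ (∈-++⁺ʳ A)))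

    ≗⇒≋ : {g g′ : ZVec n} → g ≗ g′ → (g ∷ []) ≋ (g′ ∷ [])
    ≗⇒≋ e = (λ { (here refl) → span-resp (span-gen (here refl)) (λ i → sym (e i)) }) ,
            (λ { (here refl) → span-resp (span-gen (here refl)) e })

    euclid-step : ∀ (a b : ZVec n) q → (a ∷ b ∷ []) ≋ (b ∷ (λ i → a i - q * b i) ∷ [])
    euclid-step a b q = forth , back
      where
      rebuild : ∀ x q y → x ≡ q * y + (x - q * y)
      rebuild = solve-∀
      reduce : ∀ x q y → x - q * y ≡ (- q) * y + x
      reduce = solve-∀
      forth : (a ∷ b ∷ []) ⊑ (b ∷ (λ i → a i - q * b i) ∷ [])
      forth (here refl)         =
        span-step q (here refl) (span-gen (there (here refl))) (λ i → rebuild (a i) q (b i))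
      forth (there (here refl)) = span-gen (here refl)
      back : (b ∷ (λ i → a i - q * b i) ∷ []) ⊑ (a ∷ b ∷ [])
      back (here refl)         = span-gen (there (here refl))
      back (there (here refl)) =
        span-step (- q) (there (here refl)) (span-gen (here refl)) (λ i → reduce (a i) q (b i))

    span-∷⁻ : ∀ {x : ZVec n} {G v} → Span (x ∷ G) v → Σ ℤ λ c → Span G (λ i → v i - c * x i)
    span-∷⁻ {x} {v = v} (span-zero p) =
      +0 , span-zero (λ i → trans (cong (λ y → y - +0 * x i) (p i)) (vanish (x i)))
      where
      vanish : ∀ y → +0 - +0 * y ≡ +0
      vanish = solve-∀
    span-∷⁻ {x} {v = v} (span-step {w = w} c (here refl) s p) with span-∷⁻ s
    ... | d , s′ = d + c , span-resp s′ (λ i → sym (trans (cong (λ y → y - (d + c) * x i) (p i)) (absorb c (x i) (w i) d)))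
      where
      absorb : ∀ c y w d → c * y + w - (d + c) * y ≡ w - d * y
      absorb = solve-∀
    span-∷⁻ {x} {v = v} (span-step {g = g} {w = w} c (there m) s p) with span-∷⁻ s
    ... | d , s′ = d , span-step c m s′ (λ i → trans (cong (λ y → y - d * x i) (p i)) (reassoc c (g i) (w i) d (x i)))
      where
      reassoc : ∀ c y w d z → c * y + w - d * z ≡ c * y + (w - d * z)
      reassoc = solve-∀

    span-∷⁺ : ∀ {x : ZVec n} {G v} c → Span G (λ i → v i - c * x i) → Span (x ∷ G) v
    span-∷⁺ {x} {v = v} c s =
      span-step c (here refl) (span-mono (⊆⇒⊑ there) s) (λ i → split-off (v i) c (x i))
      where
      split-off : ∀ y c z → y ≡ c * z + (y - c * z)
      split-off = solve-∀

    span-head-zero : ∀ {G : List (ZVec (suc n))} → (∀ {g} → g ∈ G → g zero ≡ +0) →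
                     ∀ {v} → Span G v → v zero ≡ +0
    span-head-zero hz (span-zero p) = p zero
    span-head-zero hz (span-step c m s p) =
      trans (p zero) (trans (cong₂ (λ a b → c * a + b) (hz m) (span-head-zero hz s)) (vanish c))
      where
      vanish : ∀ c → c * +0 + +0 ≡ +0
      vanish = solve-∀

  cons0 : ∀ {n} → ZVec n → ZVec (suc n)
  cons0 z zero    = +0
  cons0 z (suc i) = z i

  tail : ∀ {n} → ZVec (suc n) → ZVec n
  tail v i = v (suc i)

  cons0-linear : ∀ {n} → Linear n (suc n)
  cons0-linear = record
    { apply          = cons0
    ; preserves-zero = λ { p zero → refl ; p (suc j) → p j }
    ; preserves-comb = λ { c p zero → vanish c ; c p (suc j) → p j }
    }
    where
    vanish : ∀ c → +0 ≡ c * +0 + +0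
    vanish = solve-∀

  tail-linear : ∀ {n} → Linear (suc n) n
  tail-linear = record
    { apply = tail ; preserves-zero = λ p j → p (suc j) ; preserves-comb = λ c p j → p (suc j) }

  module _ {n : ℕ} {Z : List (ZVec n)} where

    span-cons0 : ∀ {w} → Span Z w → Span (map cons0 Z) (cons0 w)
    span-cons0 = span-map cons0-linear (λ m → span-gen (∈-map⁺ cons0 m))

    span-tail : ∀ {w} → Span (map cons0 Z) w → Span Z (tail w)
    span-tail = span-map tail-linear gen
      where
      gen : ∀ {g} → g ∈ map cons0 Z → Span Z (tail g)
      gen m with ∈-map⁻ cons0 m
      ... | _ , m′ , refl = span-gen m′

    span-cons0-head : ∀ {w} → Span (map cons0 Z) w → w zero ≡ +0
    span-cons0-head = span-head-zero gen
      where
      gen : ∀ {g} → g ∈ map cons0 Z → g zero ≡ +0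
      gen m with ∈-map⁻ cons0 m
      ... | _ , _ , refl = refl

  divide : ∀ x y → y ≢ +0 → Σ ℤ λ q → ∣ x - q * y ∣ ℕ.< ∣ y ∣
  divide x y y≢0 = x / y , subst (λ r → ∣ r ∣ ℕ.< ∣ y ∣) (sym remainder) (n%d<d x y)
    where
    instance _ = ≢-nonZero y≢0
    cancel : ∀ r s → r + s - s ≡ r
    cancel = solve-∀
    remainder : x - (x / y) * y ≡ + (x % y)
    remainder = trans (cong (_- (x / y) * y) (a≡a%n+[a/n]*n x y)) (cancel (+ (x % y)) ((x / y) * y))

  module _ {n : ℕ} where

    -- Euclid's algorithm on the first coordinates: {a, b} spans the same lattice
    -- as {a′, cons0 z} for some a′, z.  The fuel bounds |b₀|, which strictly decreases.
    euclid : ∀ (fuel : ℕ) (a b : ZVec (suc n)) → ∣ b zero ∣ ℕ.< fuel →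
             Σ (ZVec (suc n)) λ a′ → Σ (ZVec n) λ z → (a ∷ b ∷ []) ≋ (a′ ∷ cons0 z ∷ [])
    euclid (suc fuel) a b bound with b zero ≟ +0
    ... | yes b₀≡0 = a , tail b , ≋-++ {A = a ∷ []} ≋-refl (≗⇒≋ b≗cons0)
      where
      b≗cons0 : b ≗ cons0 (tail b)
      b≗cons0 zero    = b₀≡0
      b≗cons0 (suc i) = refl
    ... | no b₀≢0 with divide (a zero) (b zero) b₀≢0
    ...   | q , smaller with euclid fuel b (λ i → a i - q * b i) (ℕP.<-≤-trans smaller (ℕP.≤-pred bound))
    ...     | a′ , z , same = a′ , z , ≋-trans (euclid-step a b q) same

    echelon : (G : List (ZVec (suc n))) →
              Σ (ZVec (suc n)) λ h → Σ (List (ZVec n)) λ Z → G ≋ (h ∷ map cons0 Z)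
    echelon []      = (λ _ → +0) , [] , (λ ()) , (λ { (here refl) → span-zero (λ _ → refl) })
    echelon (g ∷ G) with echelon G
    ... | h , Z , G≋ with euclid (suc ∣ h zero ∣) g h ℕP.≤-refl
    ...   | h′ , z , gh≋ = h′ , z ∷ Z , ≋-trans (≋-++ {A = g ∷ []} ≋-refl G≋) (≋-++ gh≋ ≋-refl)

    -- Membership in an echelon lattice: the coefficient c of h is forced by the first
    -- coordinate, and the remaining coordinates must lie in ⟨Z⟩.
    EchelonWitness : ZVec (suc n) → List (ZVec n) → ZVec (suc n) → Set
    EchelonWitness h Z v =
      Σ ℤ λ c → (v zero ≡ c * h zero) × Span Z (λ i → tail v i - c * tail h i)

    echelon-span⁻ : ∀ {h Z v} → Span (h ∷ map cons0 Z) v → EchelonWitness h Z v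
    echelon-span⁻ {h} {v = v} s with span-∷⁻ s
    ... | c , s′ = c , head-eq (span-cons0-head s′) , span-tail s′
      where
      head-eq : v zero - c * h zero ≡ +0 → v zero ≡ c * h zero
      head-eq e = trans (sym (rebuild (v zero) (c * h zero))) (trans (cong (_+ c * h zero) e) (ℤP.+-identityˡ _))
        where
        rebuild : ∀ x y → x - y + y ≡ x
        rebuild = solve-∀

    echelon-span⁺ : ∀ {h Z v} → EchelonWitness h Z v → Span (h ∷ map cons0 Z) v
    echelon-span⁺ {h} {v = v} (c , e , s) = span-∷⁺ c (span-resp (span-cons0 s) agree)
      where
      cancel : ∀ x → +0 ≡ x - x
      cancel = solve-∀
      agree : cons0 (λ i → tail v i - c * tail h i) ≗ (λ i → v i - c * h i)
      agree zero    = trans (cancel (c * h zero)) (cong (_- c * h zero) (sym e))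
      agree (suc i) = refl

  _∣?_ : (k z : ℤ) → Dec (k ∣ z)
  k ∣? z = map′ ∣ᵤ⇒∣ ∣⇒∣ᵤ (∣ k ∣ ℕD.∣? ∣ z ∣)

  module _ {n : ℕ} (span? : ∀ (Z : List (ZVec n)) w → Dec (Span Z w))
                  (h : ZVec (suc n)) (Z : List (ZVec n)) (v : ZVec (suc n)) where

    -- Zero pivot h₀ = 0: the witness needs v₀ = 0, and c is unconstrained, so
    -- the remaining condition is tail v ∈ ⟨tail h ∷ Z⟩.
    zero-pivot-witness? : h zero ≡ +0 → Dec (EchelonWitness h Z v)
    zero-pivot-witness? h₀≡0 = decide (v zero ≟ +0)
      where
      c·h₀≡0 : ∀ c → c * h zero ≡ +0
      c·h₀≡0 c = trans (cong (c *_) h₀≡0) (ℤP.*-zeroʳ c)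
      decide : Dec (v zero ≡ +0) → Dec (EchelonWitness h Z v)
      decide (no v₀≢0)  = no λ { (c , e , _) → v₀≢0 (trans e (c·h₀≡0 c)) }
      decide (yes v₀≡0) =
        map′ (λ s → let (c , s′) = span-∷⁻ s in c , trans v₀≡0 (sym (c·h₀≡0 c)) , s′)
             (λ { (c , _ , s) → span-∷⁺ c s })
             (span? (tail h ∷ Z) (tail v))

    -- Nonzero pivot: a witness exists only if h₀ ∣ v₀, and then c = v₀ / h₀.
    pivot-witness? : h zero ≢ +0 → Dec (EchelonWitness h Z v)
    pivot-witness? h₀≢0 = decide (h zero ∣? v zero)
      where
      decide : Dec (h zero ∣ v zero) → Dec (EchelonWitness h Z v)
      decide (no h₀∤v₀)          = no λ { (c , e , _) → h₀∤v₀ (divides c e) }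
      decide (yes (divides q e)) =
        map′ (λ s → q , e , s)
             (λ { (c , e′ , s) → subst (λ c → Span Z (λ i → tail v i - c * tail h i)) (forced c e′) s })
             (span? Z (λ i → tail v i - q * tail h i))
        where
        forced : ∀ c → v zero ≡ c * h zero → c ≡ q
        forced c e′ = ℤP.*-cancelʳ-≡ c q (h zero) {{≢-nonZero h₀≢0}} (trans (sym e′) e)

    echelon-witness? : Dec (EchelonWitness h Z v)
    echelon-witness? with h zero ≟ +0
    ... | yes h₀≡0 = zero-pivot-witness? h₀≡0
    ... | no h₀≢0  = pivot-witness? h₀≢0

  span? : ∀ n (G : List (ZVec n)) v → Dec (Span G v)
  span? zero    G v = yes (span-zero (λ ()))
  span? (suc n) G v with echelon G
  ... | h , Z , G⊑E , E⊑G =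
    map′ (λ w → span-mono E⊑G (echelon-span⁺ w)) (λ s → echelon-span⁻ (span-mono G⊑E s))
         (echelon-witness? (span? n) h Z v)

open IntegerLattice

module RingEvaluation (E : Ring 0ℓ 0ℓ) where

  open Ring E hiding (zero) renaming (refl to ≈-refl; sym to ≈-sym; trans to ≈-trans)
  open import Relation.Binary.Reasoning.Setoid setoid
  open import Algebra.Properties.Ring E using (-0#≈0#; -‿involutive; -‿+-comm; -‿distribˡ-*)
  open import Algebra.Properties.CommutativeSemigroup +-commutativeSemigroup using (interchange)

  ιℕ : ℕ → Carrier
  ιℕ zero    = 0#
  ιℕ (suc n) = 1# + ιℕ n

  ι : ℤ → Carrier
  ι (+ n)    = ιℕ n
  ι -[1+ n ] = - ιℕ (suc n)

  ι-≡ : ∀ {x y} → x ≡ y → ι x ≈ ι y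
  ι-≡ refl = ≈-refl

  ι-one : ι (+ 1) ≈ 1#
  ι-one = +-identityʳ 1#

  ι-neg : ∀ z → ι (ℤ.- z) ≈ - ι z
  ι-neg (+ zero)   = ≈-sym -0#≈0#
  ι-neg (+ suc n)  = ≈-refl
  ι-neg -[1+ n ]   = ≈-sym (-‿involutive _)

  -- Needed for ι(1 + y) when y is negative.
  cancel-one : ∀ x → 1# + - (1# + x) ≈ - x
  cancel-one x = begin
    1# + - (1# + x)    ≈⟨ +-congˡ (-‿+-comm 1# x) ⟨
    1# + (- 1# + - x)  ≈⟨ +-assoc _ _ _ ⟨
    (1# + - 1#) + - x  ≈⟨ +-congʳ (-‿inverseʳ 1#) ⟩
    0# + - x           ≈⟨ +-identityˡ _ ⟩
    - x                ∎

  ι-suc : ∀ y → ι (+ 1 ℤ.+ y) ≈ 1# + ι y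
  ι-suc (+ n)          = ≈-refl
  ι-suc -[1+ zero ]    = ≈-sym (≈-trans (cancel-one 0#) -0#≈0#)
  ι-suc -[1+ suc n ]   = ≈-sym (cancel-one _)

  ι-+-pos : ∀ n y → ι (+ n ℤ.+ y) ≈ ιℕ n + ι y
  ι-+-pos zero    y = ≈-trans (ι-≡ (ℤP.+-identityˡ y)) (≈-sym (+-identityˡ _))
  ι-+-pos (suc n) y = begin
    ι (+ suc n ℤ.+ y)         ≈⟨ ι-≡ (ℤP.+-assoc (+ 1) (+ n) y) ⟩
    ι (+ 1 ℤ.+ (+ n ℤ.+ y))   ≈⟨ ι-suc (+ n ℤ.+ y) ⟩
    1# + ι (+ n ℤ.+ y)        ≈⟨ +-congˡ (ι-+-pos n y) ⟩
    1# + (ιℕ n + ι y)         ≈⟨ +-assoc _ _ _ ⟨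
    (1# + ιℕ n) + ι y         ∎

  ι-+ : ∀ x y → ι (x ℤ.+ y) ≈ ι x + ι y
  ι-+ (+ n)    y = ι-+-pos n y
  ι-+ -[1+ n ] y = begin
    ι (-[1+ n ] ℤ.+ y)                  ≈⟨ ι-≡ (flip (+ suc n) y) ⟩
    ι (ℤ.- (+ suc n ℤ.+ ℤ.- y))         ≈⟨ ι-neg (+ suc n ℤ.+ ℤ.- y) ⟩
    - ι (+ suc n ℤ.+ ℤ.- y)             ≈⟨ -‿cong (ι-+-pos (suc n) (ℤ.- y)) ⟩
    - (ιℕ (suc n) + ι (ℤ.- y))          ≈⟨ -‿+-comm _ _ ⟨
    - ιℕ (suc n) + - ι (ℤ.- y)          ≈⟨ +-congˡ (-‿cong (ι-neg y)) ⟩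
    - ιℕ (suc n) + - - ι y              ≈⟨ +-congˡ (-‿involutive _) ⟩
    - ιℕ (suc n) + ι y                  ∎
    where
    flip : ∀ a y → ℤ.- a ℤ.+ y ≡ ℤ.- (a ℤ.+ ℤ.- y)
    flip = solve-∀

  ι-*-pos : ∀ n y → ι (+ n ℤ.* y) ≈ ιℕ n * ι y
  ι-*-pos zero    y = ≈-trans (ι-≡ (ℤP.*-zeroˡ y)) (≈-sym (zeroˡ _))
  ι-*-pos (suc n) y = begin
    ι (+ suc n ℤ.* y)            ≈⟨ ι-≡ (unfold (+ n) y) ⟩
    ι (y ℤ.+ + n ℤ.* y)          ≈⟨ ι-+ y _ ⟩
    ι y + ι (+ n ℤ.* y)          ≈⟨ +-congˡ (ι-*-pos n y) ⟩
    ι y + ιℕ n * ι y             ≈⟨ +-congʳ (*-identityˡ _) ⟨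
    1# * ι y + ιℕ n * ι y        ≈⟨ distribʳ _ _ _ ⟨
    (1# + ιℕ n) * ι y            ∎
    where
    unfold : ∀ a y → (+ 1 ℤ.+ a) ℤ.* y ≡ y ℤ.+ a ℤ.* y
    unfold = solve-∀

  ι-* : ∀ x y → ι (x ℤ.* y) ≈ ι x * ι y
  ι-* (+ n)    y = ι-*-pos n y
  ι-* -[1+ n ] y = begin
    ι (-[1+ n ] ℤ.* y)          ≈⟨ ι-≡ (flip (+ suc n) y) ⟩
    ι (ℤ.- (+ suc n ℤ.* y))     ≈⟨ ι-neg (+ suc n ℤ.* y) ⟩
    - ι (+ suc n ℤ.* y)         ≈⟨ -‿cong (ι-*-pos (suc n) y) ⟩
    - (ιℕ (suc n) * ι y)        ≈⟨ -‿distribˡ-* _ _ ⟩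
    - ιℕ (suc n) * ι y          ∎
    where
    flip : ∀ a y → (ℤ.- a) ℤ.* y ≡ ℤ.- (a ℤ.* y)
    flip = solve-∀

  sumE-zero : ∀ m {f : Fin m → Carrier} → (∀ i → f i ≈ 0#) → sumE E m f ≈ 0#
  sumE-zero zero    p = ≈-refl
  sumE-zero (suc m) p = ≈-trans (+-cong (p zero) (sumE-zero m (λ i → p (suc i)))) (+-identityʳ 0#)

  sumE-linear : ∀ m a {f g h : Fin m → Carrier} → (∀ i → f i ≈ a * g i + h i) →
                sumE E m f ≈ a * sumE E m g + sumE E m h
  sumE-linear zero    a p = ≈-sym (≈-trans (+-identityʳ _) (zeroʳ a))
  sumE-linear (suc m) a {f} {g} {h} p = begin
    f zero + sumE E m (λ i → f (suc i))
      ≈⟨ +-cong (p zero) (sumE-linear m a (λ i → p (suc i))) ⟩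
    (a * g zero + h zero) + (a * sumE E m (λ i → g (suc i)) + sumE E m (λ i → h (suc i)))
      ≈⟨ interchange _ _ _ _ ⟩
    (a * g zero + a * sumE E m (λ i → g (suc i))) + (h zero + sumE E m (λ i → h (suc i)))
      ≈⟨ +-congʳ (distribˡ _ _ _) ⟨
    a * sumE E (suc m) g + sumE E (suc m) h ∎

  sumE-cong : ∀ m {f g : Fin m → Carrier} → (∀ i → f i ≈ g i) → sumE E m f ≈ sumE E m g
  sumE-cong zero    p = ≈-refl
  sumE-cong (suc m) p = +-cong (p zero) (sumE-cong m (λ i → p (suc i)))

  pairing : ∀ {m} → ZVec m → (Fin m → Carrier) → Carrier
  pairing {m} v c = sumE E m (λ i → ι (v i) * c i)

  pairing-span : ∀ {m} {G : List (ZVec m)} (c : Fin m → Carrier) →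
                 (∀ {g} → g ∈ G → pairing g c ≈ 0#) → ∀ {v} → Span G v → pairing v c ≈ 0#
  pairing-span {m} c gen (span-zero p) =
    sumE-zero m (λ i → ≈-trans (*-congʳ (ι-≡ (p i))) (zeroˡ (c i)))
  pairing-span {m} c gen (span-step {v = v} {g = g} {w = w} a mem s p) = begin
    pairing v c                   ≈⟨ sumE-linear m (ι a) term ⟩
    ι a * pairing g c + pairing w c ≈⟨ +-cong (*-congˡ (gen mem)) (pairing-span c gen s) ⟩
    ι a * 0# + 0#                 ≈⟨ +-identityʳ _ ⟩
    ι a * 0#                      ≈⟨ zeroʳ _ ⟩
    0#                            ∎
    where
    term : ∀ i → ι (v i) * c i ≈ ι a * (ι (g i) * c i) + ι (w i) * c i
    term i = begin
      ι (v i) * c i                          ≈⟨ *-congʳ (ι-≡ (p i)) ⟩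
      ι (a ℤ.* g i ℤ.+ w i) * c i            ≈⟨ *-congʳ (≈-trans (ι-+ (a ℤ.* g i) (w i)) (+-congʳ (ι-* a (g i)))) ⟩
      (ι a * ι (g i) + ι (w i)) * c i        ≈⟨ distribʳ _ _ _ ⟩
      ι a * ι (g i) * c i + ι (w i) * c i    ≈⟨ +-congʳ (*-assoc _ _ _) ⟩
      ι a * (ι (g i) * c i) + ι (w i) * c i  ∎

lift : ∀ {k} → Vec Bool k → ZVec (suc k)
lift x zero    = + 1
lift x (suc i) = b2ℤ (lookup x i)

allVecs : (k : ℕ) → List (Vec Bool k)
allVecs zero    = [] ∷ []
allVecs (suc k) = map (true ∷_) (allVecs k) ++ map (false ∷_) (allVecs k)

allVecs-complete : ∀ {k} (x : Vec Bool k) → x ∈ allVecs k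
allVecs-complete []                = here refl
allVecs-complete (true ∷ x)        = ∈-++⁺ˡ (∈-map⁺ (true ∷_) (allVecs-complete x))
allVecs-complete {suc k} (false ∷ x) =
  ∈-++⁺ʳ (map (true ∷_) (allVecs k)) (∈-map⁺ (false ∷_) (allVecs-complete x))

sumℤ-cong : ∀ m {f g : Fin m → ℤ} → f ≗ g → sumℤ m f ≡ sumℤ m g
sumℤ-cong zero    p = refl
sumℤ-cong (suc m) p = cong₂ ℤ._+_ (p zero) (sumℤ-cong m (λ i → p (suc i)))

module _ {k : ℕ} (R : BoolRel k) where

  generators : List (ZVec (suc k))
  generators = map lift (filter (λ x → R x ≟ᵇ true) (allVecs k))

  lift-generator : ∀ {x} → R x ≡ true → lift x ∈ generators
  lift-generator {x} x∈R = ∈-map⁺ lift (∈-filter⁺ (λ x → R x ≟ᵇ true) (allVecs-complete x) x∈R)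

  generator-lift : ∀ {g} → g ∈ generators → Σ (Vec Bool k) λ x → (R x ≡ true) × (g ≡ lift x)
  generator-lift m with ∈-map⁻ lift m
  ... | x , m′ , g≡lift = x , proj₂ (∈-filter⁻ (λ x → R x ≟ᵇ true) {xs = allVecs k} m′) , g≡lift

  combination-in-span : ∀ m (α : Fin m → ℤ) (t : Fin m → Vec Bool k) → (∀ i → R (t i) ≡ true) →
                        Span generators (λ j → sumℤ m (λ i → α i ℤ.* lift (t i) j))
  combination-in-span zero    α t t∈R = span-zero (λ _ → refl)
  combination-in-span (suc m) α t t∈R =
    span-step (α zero) (lift-generator (t∈R zero))
      (combination-in-span m (λ i → α (suc i)) (λ i → t (suc i)) (λ i → t∈R (suc i)))
      (λ _ → refl)

  -- If no tuple outside R lifts into the lattice of R, then R is balanced: the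
  -- leading coordinate turns Σ αᵢ = 1 into the leading 1 of the lifted result.
  closed⇒balanced : (∀ r → R r ≡ false → ¬ Span generators (lift r)) → Balanced k R
  closed⇒balanced closed m α Σα≡1 t t∈R r result with R r in r-value
  ... | true  = refl
  ... | false = ⊥-elim (closed r r-value (span-resp (combination-in-span m α t t∈R) lifted))
    where
    lifted : (λ j → sumℤ m (λ i → α i ℤ.* lift (t i) j)) ≗ lift r
    lifted zero    = trans (sumℤ-cong m (λ i → ℤP.*-identityʳ (α i))) Σα≡1
    lifted (suc j) = result j

module _ (E : Ring 0ℓ 0ℓ) where

  open Ring E hiding (zero) renaming (refl to ≈-refl; sym to ≈-sym; trans to ≈-trans)
  open RingEvaluation E

  coefficients : ∀ {k} → LinPoly E k → Fin (suc k) → Carrier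
  coefficients (linPoly c₀ c) zero    = c₀
  coefficients (linPoly c₀ c) (suc i) = c i

  pairing-evalLin : ∀ {k} (p : LinPoly E k) x → pairing (lift x) (coefficients p) ≈ evalLin E p x
  pairing-evalLin {k} (linPoly c₀ c) x =
    +-cong (≈-trans (*-congʳ ι-one) (*-identityˡ c₀)) (sumE-cong k (λ i → bit (lookup x i) (c i)))
    where
    bit : ∀ b a → ι (b2ℤ b) * a ≈ a * (if b then 1# else 0#)
    bit true  a = ≈-trans (*-congʳ ι-one) (≈-trans (*-identityˡ a) (≈-sym (*-identityʳ a)))
    bit false a = ≈-trans (zeroˡ a) (≈-sym (zeroʳ a))

  lattice-not-captured : ∀ {k} (R : BoolRel k) {u} → Span (generators R) (lift u) →
                         (p : LinPoly E k) → ¬ Captures E R p u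
  lattice-not-captured R {u} u∈L p (vanishes , nonzero) =
    nonzero (≈-trans (≈-sym (pairing-evalLin p u)) (pairing-span (coefficients p) on-generators u∈L))
    where
    on-generators : ∀ {g} → g ∈ generators R → pairing g (coefficients p) ≈ 0#
    on-generators m with generator-lift R m
    ... | x , x∈R , refl = ≈-trans (pairing-evalLin p x) (vanishes x x∈R)

-- Decide whether some u ∉ R lifts into the lattice of R.  If so, u is the
-- required tuple; if not, R would be balanced.
theorem4p4 : (k : ℕ) (R : BoolRel k) → ¬ Balanced k R →
    Σ (Vec Bool k) (λ u → (R u ≡ false) ×
      ((E : Ring 0ℓ 0ℓ) (p : LinPoly E k) → ¬ Captures E R p u))
theorem4p4 k R not-balanced
  with anySubset? (λ u → (R u ≟ᵇ false) ×-dec span? (suc k) (generators R) (lift u))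
... | yes (u , u∉R , u∈L) = u , u∉R , λ E → lattice-not-captured E R u∈L
... | no none = ⊥-elim (not-balanced (closed⇒balanced R (λ r r∉R r∈L → none (r , r∉R , r∈L))))
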